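{- Let $G$ be a finite simple graph on $[d]$ and $<$ a monomial order on $R[G]$. Let $\mathcal{G}_1$ be the reduced Gröbner basis of $J_G$ with respect to $<$, and let $\mathcal{G}_2=\{x_Sx_T : S,T\in S(G),\ S\cap T\ne\emptyset\}$. Then $\mathcal{G}=(\mathcal{G}_1\setminus M_G)\cup\mathcal{G}_2$ is the reduced Gröbner basis of $K_G$ with respect to $<$.
   Context: $G$ is a simple graph on $[d]$, $\mathbb{K}$ a field, $S(G)$ the set of stable sets of $G$ (subsets of $[d]$ with no edge; includes $\emptyset$ and singletons), $R[G]=\mathbb{K}[x_S:S\in S(G)]$ with all $\deg x_S=1$. For a $2$-coloring $f$ (map to $\{1,2\}$ with adjacent vertices colored differently) of an induced subgraph of $G$, ${\mathbf x}_f=x_{f^{ -1}(1)}x_{f^{ -1}(2)}$. $J_G$ is the ideal generated by all ${\mathbf x}_f-{\mathbf x}_g$ with $f,g$ $2$-colorings of the same induced subgraph of $G$. $M_G=\langle x_Sx_T : S,T\in S(G),\ S\cap T\neq\emptyset\rangle$ and $K_G=J_G+M_G$. -}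

module Defs where

open import Level using (Level; _⊔_) renaming (suc to lsuc; zero to lzero)
open import Data.Nat as ℕ using (ℕ)
import Data.Nat.Properties as ℕP
open import Data.Bool as Bool using (Bool; true; false; _∧_)
open import Data.Maybe using (Maybe; just; nothing; is-just)
open import Data.Fin using (Fin; zero; suc)
import Data.Fin.Properties as FinP
open import Data.Fin.Subset using (Subset; inside; outside; _∈_; _∩_; Nonempty)
open import Data.Fin.Subset.Properties using (_∈?_)
open import Data.Vec as Vec using (Vec; []; _∷_; lookup; tabulate; zipWith; replicate)
import Data.Vec.Properties as VecP
open import Data.List as List using (List; []; _∷_; _++_; map; concatMap; filter; length)
open import Data.List.Relation.Unary.All using (All)
open import Data.Product using (Σ; ∃; ∃-syntax; _×_; _,_; proj₁; proj₂)
open import Data.Sum using (_⊎_)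
open import Relation.Nullary using (¬_; Dec; yes; no; does)
open import Relation.Nullary.Decidable using (_→-dec_)
open import Relation.Unary using (Pred)
open import Relation.Binary using (Rel)
open import Relation.Binary.Structures using (IsStrictTotalOrder)
open import Relation.Binary.PropositionalEquality using (_≡_; _≢_)
open import Induction.WellFounded using (WellFounded)
open import Algebra.Bundles using (CommutativeRing)

record Field (c ℓ : Level) : Set (lsuc (c ⊔ ℓ)) where
  field
    commutativeRing : CommutativeRing c ℓ
  open CommutativeRing commutativeRing public
  field
    1≉0     : ¬ (1# ≈ 0#)
    inverse : ∀ x → ¬ (x ≈ 0#) → ∃[ y ] (x * y ≈ 1#)

Mon : ℕ → Set
Mon N = Vec ℕ N

_·ₘ_ : ∀ {N} → Mon N → Mon N → Mon N
_·ₘ_ = zipWith ℕ._+_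

oneₘ : ∀ {N} → Mon N
oneₘ = replicate _ 0

varₘ : ∀ {N} → Fin N → Mon N
varₘ i = tabulate (λ j → if' (does (FinP._≟_ i j)))
  where
  if' : Bool → ℕ
  if' true  = 1
  if' false = 0

_∣ₘ_ : ∀ {N} → Mon N → Mon N → Set
m ∣ₘ m' = ∃[ k ] (m' ≡ m ·ₘ k)

record MonomialOrder (N : ℕ) : Set₁ where
  field
    _<_               : Rel (Mon N) lzero
    isStrictTotalOrder : IsStrictTotalOrder _≡_ _<_
    multiplicative    : ∀ a b c → a < b → (a ·ₘ c) < (b ·ₘ c)
    wellFounded       : WellFounded _<_

  _≤_ : Rel (Mon N) lzero
  a ≤ b = a < b ⊎ a ≡ b

-- Polynomials over a field F in N variables, represented as formal
-- (unnormalised) finite sums of terms; two polynomials are equal when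
-- all their coefficients agree.

module PolyRing {c ℓ} (F : Field c ℓ) (N : ℕ) where
  open Field F

  Poly : Set c
  Poly = List (Carrier × Mon N)

  coeff : Poly → Mon N → Carrier
  coeff []             m = 0#
  coeff ((a , m') ∷ p) m with VecP.≡-dec ℕP._≟_ m' m
  ... | yes _ = a + coeff p m
  ... | no  _ = coeff p m

  infix 4 _≈ₚ_
  _≈ₚ_ : Poly → Poly → Set ℓ
  p ≈ₚ q = ∀ m → coeff p m ≈ coeff q m

  0ₚ : Poly
  0ₚ = []

  _+ₚ_ : Poly → Poly → Poly
  _+ₚ_ = _++_

  -ₚ_ : Poly → Poly
  -ₚ_ = map (λ t → (- proj₁ t , proj₂ t))

  _-ₚ_ : Poly → Poly → Poly
  p -ₚ q = p +ₚ (-ₚ q)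

  _*ₚ_ : Poly → Poly → Poly
  p *ₚ q = concatMap (λ s → map (λ t → (proj₁ s * proj₁ t , proj₂ s ·ₘ proj₂ t)) q) p

  X : Fin N → Poly
  X i = (1# , varₘ i) ∷ []

  sumₚ : List Poly → Poly
  sumₚ = List.foldr _+ₚ_ 0ₚ

  Ideal : ∀ {p} → Pred Poly p → Pred Poly (c ⊔ ℓ ⊔ p)
  Ideal P f = ∃[ hs ] (All (λ hg → P (proj₂ hg)) hs
                     × f ≈ₚ sumₚ (map (λ hg → proj₁ hg *ₚ proj₂ hg) hs))

  module _ (O : MonomialOrder N) where
    open MonomialOrder O using (_≤_)

    IsLM : Poly → Mon N → Set (ℓ ⊔ lzero)
    IsLM f m = ¬ (coeff f m ≈ 0#) × (∀ m' → ¬ (coeff f m' ≈ 0#) → m' ≤ m)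

    IsGB : ∀ {b i} → Pred Poly b → Pred Poly i → Set (c ⊔ ℓ ⊔ b ⊔ i)
    IsGB B I = (∀ g → B g → I g)
             × (∀ f m → I f → IsLM f m →
                  ∃[ g ] ∃[ m' ] (B g × IsLM g m' × m' ∣ₘ m))

    IsReducedGB : ∀ {b i} → Pred Poly b → Pred Poly i → Set (c ⊔ ℓ ⊔ b ⊔ i)
    IsReducedGB B I =
        IsGB B I
      × (∀ g → B g → ∃[ m ] (IsLM g m × coeff g m ≈ 1#))
      × (∀ g g' → B g → B g' → ¬ (g' ≈ₚ g) →
           ∀ m m' → ¬ (coeff g m ≈ 0#) → IsLM g' m' → ¬ (m' ∣ₘ m))

record SimpleGraph (d : ℕ) : Set where
  field
    adj   : Fin d → Fin d → Bool
    sym   : ∀ i j → adj i j ≡ adj j i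
    irrefl : ∀ i → adj i i ≡ false

module _ {d : ℕ} (G : SimpleGraph d) where
  open SimpleGraph G

  Stable : Subset d → Set
  Stable S = ∀ i j → i ∈ S → j ∈ S → adj i j ≡ false

  stable? : ∀ S → Dec (Stable S)
  stable? S = FinP.all? λ i → FinP.all? λ j →
    (i ∈? S) →-dec ((j ∈? S) →-dec (adj i j Bool.≟ false))

allSubsets : (n : ℕ) → List (Subset n)
allSubsets ℕ.zero    = [] ∷ []
allSubsets (ℕ.suc n) = map (inside ∷_) (allSubsets n) ++ map (outside ∷_) (allSubsets n)

module GraphIdeals {d : ℕ} (G : SimpleGraph d) where
  open SimpleGraph G

  stableSets : List (Subset d)
  stableSets = filter (stable? G) (allSubsets d)

  -- R[G] has one variable x_S for each stable set S; variables are
  -- indexed by Fin nVars, variable k standing for the stable set varSet k.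
  nVars : ℕ
  nVars = length stableSets

  varSet : Fin nVars → Subset d
  varSet = List.lookup stableSets

  -- A 2-colouring of an induced subgraph of G: c i = nothing means i is
  -- not in the vertex set W of the induced subgraph, c i = just b means
  -- i ∈ W has colour b (true = colour 1, false = colour 2); adjacent
  -- vertices get different colours.
  Coloring : Set
  Coloring = Fin d → Maybe Bool

  IsTwoColoring : Coloring → Set
  IsTwoColoring f = ∀ i j b → adj i j ≡ true → f i ≡ just b → f j ≢ just b

  SameDomain : Coloring → Coloring → Set
  SameDomain f g = ∀ i → is-just (f i) ≡ is-just (g i)

  preimage : Coloring → Bool → Subset d
  preimage f b = tabulate (λ i → eqMB (f i) b)
    where
    eqMB : Maybe Bool → Bool → Bool
    eqMB nothing  _ = false
    eqMB (just x) b = does (x Bool.≟ b)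

  module _ {c ℓ} (F : Field c ℓ) where
    open PolyRing F nVars

    -- x_f = x_{f⁻¹(1)} x_{f⁻¹(2)} as the monomial X k * X l
    IsXf : Coloring → Fin nVars → Fin nVars → Set
    IsXf f k l = varSet k ≡ preimage f true × varSet l ≡ preimage f false

    JGen : Pred Poly c
    JGen p = ∃[ f ] ∃[ g ] (IsTwoColoring f × IsTwoColoring g × SameDomain f g
             × ∃[ i ] ∃[ j ] ∃[ k ] ∃[ l ]
                 (IsXf f i j × IsXf g k l × p ≡ (X i *ₚ X j) -ₚ (X k *ₚ X l)))

    -- generators x_S x_T (S ∩ T ≠ ∅) of M_G; this is also the set 𝒢₂
    MGen : Pred Poly c
    MGen p = ∃[ i ] ∃[ j ] (Nonempty (varSet i ∩ varSet j) × p ≡ X i *ₚ X j)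

    J : Pred Poly (c ⊔ ℓ)
    J = Ideal JGen

    M : Pred Poly (c ⊔ ℓ)
    M = Ideal MGen

    K : Pred Poly (c ⊔ ℓ)
    K = Ideal (λ p → JGen p ⊎ MGen p)

module Submission where

-- A monomial of R[G] lies in M_G exactly when it is overlapping: some vertex
-- lies in two of its factors x_S, counted with multiplicity.  Both monomials of
-- a generator x_f - x_g contain every vertex of the common domain exactly once,
-- so every multiple of x_f - x_g has either both or neither of its monomials
-- overlapping.  Hence splitting an element of J_G into its overlapping and its
-- non-overlapping part stays inside J_G, and the non-overlapping part of an
-- element of K_G = J_G + M_G lies in J_G.  A leading monomial of K_G is therefore
-- either overlapping, hence divisible by some x_S x_T with S ∩ T ≠ ∅, or a
-- leading monomial of J_G.  Reducedness of 𝒢₁ forces each g ∈ 𝒢₁ ∖ M_G to have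
-- only non-overlapping terms; as J_G has no terms of degree < 2, the leading
-- monomial of such a g cannot divide any x_S x_T either.

open import Level using (0ℓ; _⊔_)
open import Data.Bool using (Bool; true; false; if_then_else_)
open import Data.Empty using (⊥; ⊥-elim)
open import Data.Fin using (Fin; zero; suc)
open import Data.Fin.Properties using (any?)
open import Data.Fin.Subset using (Subset; _∩_; Nonempty) renaming (_∈_ to _∈ₛ_)
open import Data.Fin.Subset.Properties using (x∈p∩q⁺; x∈p∩q⁻)
open import Data.List using (List; []; _∷_; _++_; map; filter)
import Data.List.Properties as List
open import Data.List.Membership.Propositional using (_∈_; _∉_)
open import Data.List.Membership.Propositional.Properties using (∈-filter⁺)
open import Data.List.Relation.Unary.All as All using (All; []; _∷_)
import Data.List.Relation.Unary.All.Properties as All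
open import Data.List.Relation.Unary.Any using (here; there)
open import Data.Maybe using (just; nothing; is-just)
open import Data.Nat using (ℕ; zero; suc; _≤_; _<_; z≤n; s≤s; s≤s⁻¹; _≤?_; _<?_)
import Data.Nat.Properties as ℕP
open import Data.Product using (∃; ∃-syntax; _×_; _,_; proj₁; proj₂)
open import Data.Sum using (_⊎_; inj₁; inj₂; [_,_]′)
open import Data.Vec using ([]; _∷_; lookup; tabulate; replicate)
import Data.Vec.Properties as VecP
open import Function using (_∘_; const; id; flip)
open import Induction.WellFounded using (Acc; acc)
open import Relation.Binary.Bundles using (TotalOrder)
import Relation.Binary.Construct.StrictToNonStrict as StrictToNonStrict
open import Relation.Binary.Definitions using (tri<; tri≈; tri>)
open import Relation.Binary.PropositionalEquality as ≡
  using (_≡_; _≢_; refl; cong; cong₂; subst; subst₂; module ≡-Reasoning)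
open import Relation.Binary.Structures using (IsStrictTotalOrder)
open import Relation.Nullary using (¬_; Dec; yes; no; ¬?; contradiction)
open import Relation.Nullary.Decidable using (¬¬-excluded-middle)
open import Relation.Nullary.Negation using (¬¬-Monad; ¬¬-map)
open import Relation.Unary using (Pred; Decidable; ∁; _∪_; _⊆_; ∅)

open import Defs

module Monomial where
  open import Data.Nat using (_+_; _*_)
  open import Algebra.Properties.CommutativeSemigroup ℕP.+-commutativeSemigroup using (interchange)

  module _ {N : ℕ} where

    ·ₘ-comm : (a b : Mon N) → a ·ₘ b ≡ b ·ₘ a
    ·ₘ-comm = VecP.zipWith-comm ℕP.+-comm

    ·ₘ-assoc : (a b c : Mon N) → (a ·ₘ b) ·ₘ c ≡ a ·ₘ (b ·ₘ c)
    ·ₘ-assoc = VecP.zipWith-assoc ℕP.+-assoc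

    ·ₘ-identityˡ : (a : Mon N) → oneₘ ·ₘ a ≡ a
    ·ₘ-identityˡ = VecP.zipWith-identityˡ ℕP.+-identityˡ

    ·ₘ-identityʳ : (a : Mon N) → a ·ₘ oneₘ ≡ a
    ·ₘ-identityʳ = VecP.zipWith-identityʳ ℕP.+-identityʳ

    ∣ₘ-multiple : (a b : Mon N) → a ∣ₘ (b ·ₘ a)
    ∣ₘ-multiple a b = b , ·ₘ-comm b a

  varₘ-zero : ∀ {N} → varₘ {suc N} zero ≡ 1 ∷ oneₘ
  varₘ-zero = cong (1 ∷_) (tabulate-zero _)
    where
    tabulate-zero : ∀ n → tabulate {n = n} (const 0) ≡ replicate n 0
    tabulate-zero zero    = refl
    tabulate-zero (suc n) = cong (0 ∷_) (tabulate-zero n)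

  weight : ∀ {N} → (Fin N → ℕ) → Mon N → ℕ
  weight w []      = 0
  weight w (e ∷ m) = w zero * e + weight (w ∘ suc) m

  weight-·ₘ : ∀ {N} (w : Fin N → ℕ) (a b : Mon N) → weight w (a ·ₘ b) ≡ weight w a + weight w b
  weight-·ₘ w []      []      = refl
  weight-·ₘ w (x ∷ a) (y ∷ b) = begin
    w zero * (x + y) + weight (w ∘ suc) (a ·ₘ b)
      ≡⟨ cong₂ _+_ (ℕP.*-distribˡ-+ (w zero) x y) (weight-·ₘ (w ∘ suc) a b) ⟩
    (w zero * x + w zero * y) + (weight (w ∘ suc) a + weight (w ∘ suc) b)
      ≡⟨ interchange (w zero * x) (w zero * y) (weight (w ∘ suc) a) (weight (w ∘ suc) b) ⟩
    (w zero * x + weight (w ∘ suc) a) + (w zero * y + weight (w ∘ suc) b)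
      ∎
    where open ≡-Reasoning

  weight-oneₘ : ∀ {N} (w : Fin N → ℕ) → weight w oneₘ ≡ 0
  weight-oneₘ {zero}  w = refl
  weight-oneₘ {suc N} w = cong₂ _+_ (ℕP.*-zeroʳ (w zero)) (weight-oneₘ (w ∘ suc))

  weight-varₘ : ∀ {N} (w : Fin N → ℕ) (i : Fin N) → weight w (varₘ i) ≡ w i
  weight-varₘ w zero    = begin
    weight w (varₘ zero)
      ≡⟨ cong (weight w) varₘ-zero ⟩
    w zero * 1 + weight (w ∘ suc) oneₘ
      ≡⟨ cong₂ _+_ (ℕP.*-identityʳ (w zero)) (weight-oneₘ (w ∘ suc)) ⟩
    w zero + 0
      ≡⟨ ℕP.+-identityʳ (w zero) ⟩
    w zero
      ∎
    where open ≡-Reasoning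
  weight-varₘ w (suc i) =
    ≡.trans (cong (_+ weight (w ∘ suc) (varₘ i)) (ℕP.*-zeroʳ (w zero))) (weight-varₘ (w ∘ suc) i)

  ∣ₘ⇒weight≤ : ∀ {N} (w : Fin N → ℕ) {a b : Mon N} → a ∣ₘ b → weight w a ≤ weight w b
  ∣ₘ⇒weight≤ w {a} (k , refl) = subst (weight w a ≤_) (≡.sym (weight-·ₘ w a k)) (ℕP.m≤m+n _ _)

  private
    weight>0⇒∣ₘ-∷ : ∀ {N} {w : Fin (suc N) → ℕ} {m : Mon N} e →
                    ∃[ i ] (0 < w (suc i) × varₘ i ∣ₘ m) → ∃[ i ] (0 < w i × varₘ i ∣ₘ (e ∷ m))
    weight>0⇒∣ₘ-∷ e (i , w[i]>0 , k , m≡) = suc i , w[i]>0 , e ∷ k , cong (e ∷_) m≡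

  weight>0⇒∣ₘ : ∀ {N} (w : Fin N → ℕ) (m : Mon N) → 0 < weight w m →
                ∃[ i ] (0 < w i × varₘ i ∣ₘ m)
  weight>0⇒∣ₘ w (zero ∷ m) w[m]>0 = weight>0⇒∣ₘ-∷ zero
    (weight>0⇒∣ₘ (w ∘ suc) m (subst (λ h → 0 < h + weight (w ∘ suc) m) (ℕP.*-zeroʳ (w zero)) w[m]>0))
  weight>0⇒∣ₘ w (suc e ∷ m) w[m]>0 with w zero in w[0]≡
  ... | zero  = weight>0⇒∣ₘ-∷ (suc e) (weight>0⇒∣ₘ (w ∘ suc) m w[m]>0)
  ... | suc _ = zero , subst (0 <_) (≡.sym w[0]≡) (s≤s z≤n) , e ∷ m , ≡.sym (begin
    varₘ zero ·ₘ (e ∷ m)  ≡⟨ cong (_·ₘ (e ∷ m)) varₘ-zero ⟩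
    suc e ∷ oneₘ ·ₘ m     ≡⟨ cong (suc e ∷_) (·ₘ-identityˡ m) ⟩
    suc e ∷ m             ∎)
    where open ≡-Reasoning

  weight≥2⇒quadratic-∣ₘ : ∀ {N} (w : Fin N → ℕ) → (∀ k → w k ≤ 1) → (m : Mon N) → 2 ≤ weight w m →
                          ∃[ i ] ∃[ j ] (0 < w i × 0 < w j × (varₘ i ·ₘ varₘ j) ∣ₘ m)
  weight≥2⇒quadratic-∣ₘ w w≤1 m 2≤w[m] with weight>0⇒∣ₘ w m (ℕP.<-≤-trans (s≤s z≤n) 2≤w[m])
  ... | i , w[i]>0 , m₁ , refl with weight>0⇒∣ₘ w m₁ (s≤s⁻¹ (ℕP.≤-trans 2≤w[m] w[m]≤1+w[m₁]))
    where
    w[m]≤1+w[m₁] : weight w (varₘ i ·ₘ m₁) ≤ 1 + weight w m₁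
    w[m]≤1+w[m₁] = ℕP.≤-trans
      (ℕP.≤-reflexive (≡.trans (weight-·ₘ w (varₘ i) m₁) (cong (_+ weight w m₁) (weight-varₘ w i))))
      (ℕP.+-monoˡ-≤ (weight w m₁) (w≤1 i))
  ...   | j , w[j]>0 , m₂ , refl = i , j , w[i]>0 , w[j]>0 , m₂ , ≡.sym (·ₘ-assoc (varₘ i) (varₘ j) m₂)

  degree : ∀ {N} → Mon N → ℕ
  degree = weight (const 1)

  degree-quadratic : ∀ {N} (i j : Fin N) → degree (varₘ i ·ₘ varₘ j) ≡ 2
  degree-quadratic i j = ≡.trans (weight-·ₘ (const 1) (varₘ i) (varₘ j))
                                 (cong₂ _+_ (weight-varₘ (const 1) i) (weight-varₘ (const 1) j))

  2≤degree-quadratic-multiple : ∀ {N} (m : Mon N) (i j : Fin N) → 2 ≤ degree (m ·ₘ (varₘ i ·ₘ varₘ j))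
  2≤degree-quadratic-multiple m i j =
    subst (_≤ degree (m ·ₘ (varₘ i ·ₘ varₘ j))) (degree-quadratic i j)
          (∣ₘ⇒weight≤ (const 1) (∣ₘ-multiple (varₘ i ·ₘ varₘ j) m))

  degree≡0⇒≡oneₘ : ∀ {N} (m : Mon N) → degree m ≡ 0 → m ≡ oneₘ
  degree≡0⇒≡oneₘ []      _  = refl
  degree≡0⇒≡oneₘ (e ∷ m) eq = cong₂ _∷_
    (≡.trans (≡.sym (ℕP.*-identityˡ e)) (ℕP.m+n≡0⇒m≡0 (1 * e) eq))
    (degree≡0⇒≡oneₘ m (ℕP.m+n≡0⇒n≡0 (1 * e) eq))

  ∣ₘ∧degree≡⇒≡ : ∀ {N} {a b : Mon N} → a ∣ₘ b → degree a ≡ degree b → a ≡ b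
  ∣ₘ∧degree≡⇒≡ {a = a} (k , refl) eq = ≡.sym (begin
    a ·ₘ k     ≡⟨ cong (a ·ₘ_) (degree≡0⇒≡oneₘ k degree[k]≡0) ⟩
    a ·ₘ oneₘ  ≡⟨ ·ₘ-identityʳ a ⟩
    a          ∎)
    where
    open ≡-Reasoning
    degree[k]≡0 : degree k ≡ 0
    degree[k]≡0 = ≡.sym (ℕP.+-cancelˡ-≡ (degree a) 0 (degree k)
                    (≡.trans (ℕP.+-identityʳ (degree a)) (≡.trans eq (weight-·ₘ (const 1) a k))))

  quadratic-∣ₘ-quadratic : ∀ {N} {i j k l : Fin N} → (varₘ k ·ₘ varₘ l) ∣ₘ (varₘ i ·ₘ varₘ j) →
                           varₘ k ·ₘ varₘ l ≡ varₘ i ·ₘ varₘ j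
  quadratic-∣ₘ-quadratic {i = i} {j} {k} {l} q∣q' =
    ∣ₘ∧degree≡⇒≡ q∣q' (≡.trans (degree-quadratic k l) (≡.sym (degree-quadratic i j)))

open Monomial

module MonomialOrderProperties {N : ℕ} (O : MonomialOrder N) where
  open MonomialOrder O renaming (_<_ to infix 4 _≺_; _≤_ to infix 4 _≼_)
  open IsStrictTotalOrder isStrictTotalOrder using (compare)

  totalOrder : TotalOrder 0ℓ 0ℓ 0ℓ
  totalOrder = record { isTotalOrder = StrictToNonStrict.isTotalOrder _≡_ _≺_ isStrictTotalOrder }

  open TotalOrder totalOrder public using () renaming (antisym to ≼-antisym)

  ·ₘ-monoˡ-≼ : ∀ {a b} c → a ≼ b → a ·ₘ c ≼ b ·ₘ c
  ·ₘ-monoˡ-≼ c (inj₁ a≺b)  = inj₁ (multiplicative _ _ c a≺b)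
  ·ₘ-monoˡ-≼ c (inj₂ refl) = inj₂ refl

  -- If m ≺ 1 then x ≻ m·x ≻ m²·x ≻ …, contradicting well-foundedness.
  oneₘ-minimum : ∀ m → oneₘ ≼ m
  oneₘ-minimum m with compare m oneₘ
  ... | tri< m≺1 _ _ = ⊥-elim (descent (wellFounded oneₘ))
    where
    descent : ∀ {x} → Acc _≺_ x → ⊥
    descent {x} (acc rs) = descent (rs (subst (m ·ₘ x ≺_) (·ₘ-identityˡ x) (multiplicative m oneₘ x m≺1)))
  ... | tri≈ _ m≡1 _ = inj₂ (≡.sym m≡1)
  ... | tri> _ _ 1≺m = inj₁ 1≺m

  ∣ₘ⇒≼ : ∀ {a b} → a ∣ₘ b → a ≼ b
  ∣ₘ⇒≼ {a} (k , refl) = subst₂ _≼_ (·ₘ-identityˡ a) (·ₘ-comm k a) (·ₘ-monoˡ-≼ a (oneₘ-minimum k))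

module Polynomial {c ℓ} (F : Field c ℓ) (N : ℕ) where
  open Field F renaming (refl to ≈-refl; sym to ≈-sym; trans to ≈-trans)
  open PolyRing F N

  _≟ₘ_ : (a b : Mon N) → Dec (a ≡ b)
  _≟ₘ_ = VecP.≡-dec ℕP._≟_

  monomials : Poly → List (Mon N)
  monomials = map proj₂

  combination : List (Poly × Poly) → Poly
  combination hs = sumₚ (map (λ hg → proj₁ hg *ₚ proj₂ hg) hs)

  -- (s ∷ h) *ₚ g computes to s • g ++ h *ₚ g.
  infixr 7 _•_
  _•_ : Carrier × Mon N → Poly → Poly
  s • g = map (λ t → (proj₁ s * proj₁ t , proj₂ s ·ₘ proj₂ t)) g

  coeff-∷-cong : ∀ {a b m m' p q} → a ≈ b → m ≡ m' → p ≈ₚ q → ((a , m) ∷ p) ≈ₚ ((b , m') ∷ q)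
  coeff-∷-cong {m = m} a≈b refl p≈q m'' with m ≟ₘ m''
  ... | yes _ = +-cong a≈b (p≈q m'')
  ... | no  _ = p≈q m''

  support : ∀ p {m} → coeff p m ≉ 0# → m ∈ monomials p
  support []             p[m]≉0 = contradiction ≈-refl p[m]≉0
  support ((a , m') ∷ p) {m} p[m]≉0 with m' ≟ₘ m
  ... | yes m'≡m = here (≡.sym m'≡m)
  ... | no  _    = there (support p p[m]≉0)

  coeff-∉ : ∀ p {m} → m ∉ monomials p → coeff p m ≈ 0#
  coeff-∉ []             _ = ≈-refl
  coeff-∉ ((a , m') ∷ p) {m} m∉ with m' ≟ₘ m
  ... | yes m'≡m = contradiction (here (≡.sym m'≡m)) m∉
  ... | no  _    = coeff-∉ p (m∉ ∘ there)

  term-support : ∀ a m m' → coeff ((a , m) ∷ []) m' ≉ 0# → m' ≡ m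
  term-support a m m' nz with support ((a , m) ∷ []) nz
  ... | here m'≡m = m'≡m

  coeff-term : ∀ a m → coeff ((a , m) ∷ []) m ≈ a
  coeff-term a m with m ≟ₘ m
  ... | yes _   = +-identityʳ a
  ... | no  m≢m = contradiction refl m≢m

  support-X*X : ∀ i j m → coeff (X i *ₚ X j) m ≉ 0# → m ≡ varₘ i ·ₘ varₘ j
  support-X*X i j = term-support (1# * 1#) (varₘ i ·ₘ varₘ j)

  coeff-X*X : ∀ i j → coeff (X i *ₚ X j) (varₘ i ·ₘ varₘ j) ≈ 1#
  coeff-X*X i j = ≈-trans (coeff-term (1# * 1#) (varₘ i ·ₘ varₘ j)) (*-identityˡ 1#)

  -- Whether a coefficient vanishes is undecidable in general, but only the
  -- finitely many monomials of p matter, so deciding them all is ¬¬-valid.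
  ¬¬-coeff-dec : ∀ p → ¬ ¬ (∀ m → Dec (coeff p m ≈ 0#))
  ¬¬-coeff-dec p = ¬¬-map decide
    (All.sequenceM ℓ ¬¬-Monad (All.universal (λ _ → ¬¬-excluded-middle) (monomials p)))
    where
    open import Data.List.Membership.DecPropositional _≟ₘ_ using (_∈?_)
    decide : All (λ m → Dec (coeff p m ≈ 0#)) (monomials p) → ∀ m → Dec (coeff p m ≈ 0#)
    decide decs m with m ∈? monomials p
    ... | yes m∈ = All.lookup decs m∈
    ... | no  m∉ = yes (coeff-∉ p m∉)

  Ideal-mono : ∀ {p q} {P : Pred Poly p} {Q : Pred Poly q} → P ⊆ Q → Ideal P ⊆ Ideal Q
  Ideal-mono P⊆Q (hs , gens , f≈) = hs , All.map P⊆Q gens , f≈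

  Ideal-resp-≈ : ∀ {p} {P : Pred Poly p} {f f'} → f ≈ₚ f' → Ideal P f → Ideal P f'
  Ideal-resp-≈ f≈f' (hs , gens , f≈) = hs , gens , λ m → ≈-trans (≈-sym (f≈f' m)) (f≈ m)

  Ideal-[] : ∀ {p} {P : Pred Poly p} → Ideal P []
  Ideal-[] = [] , [] , λ _ → ≈-refl

  Ideal-∷ : ∀ {p} {P : Pred Poly p} i j {a m f} → P (X i *ₚ X j) → (varₘ i ·ₘ varₘ j) ∣ₘ m →
            Ideal P f → Ideal P ((a , m) ∷ f)
  Ideal-∷ i j {a} P[x_ix_j] (k , m≡) (hs , gens , f≈) =
    ((a , k) ∷ [] , X i *ₚ X j) ∷ hs , P[x_ix_j] ∷ gens ,
    coeff-∷-cong (≈-sym (≈-trans (*-congˡ (*-identityˡ 1#)) (*-identityʳ a)))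
                 (≡.trans m≡ (·ₘ-comm (varₘ i ·ₘ varₘ j) k)) f≈

  Ideal-X*X : ∀ {p} {P : Pred Poly p} i j → P (X i *ₚ X j) → Ideal P (X i *ₚ X j)
  Ideal-X*X i j P[x_ix_j] = Ideal-∷ i j P[x_ix_j] (oneₘ , ≡.sym (·ₘ-identityʳ _)) Ideal-[]

  module _ {r} (R : Pred (Mon N) r) where

    Homogeneous : Pred Poly (c ⊔ r)
    Homogeneous g = ∀ m → All (λ t → R (m ·ₘ proj₂ t)) g ⊎ All (λ t → ¬ R (m ·ₘ proj₂ t)) g

    Avoids : Pred Poly (c ⊔ r)
    Avoids g = ∀ m → All (λ t → ¬ R (m ·ₘ proj₂ t)) g

  Homogeneous-∁ : ∀ {r} {R : Pred (Mon N) r} {g} → Homogeneous R g → Homogeneous (∁ R) g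
  Homogeneous-∁ hom m = [ inj₂ ∘ All.map (λ r ¬r → ¬r r) , inj₁ ]′ (hom m)

  module _ {r} {R : Pred (Mon N) r} (R? : Decidable R) where

    restrict : Poly → Poly
    restrict = filter (R? ∘ proj₂)

    coeff-restrict : ∀ p {m} → R m → coeff (restrict p) m ≈ coeff p m
    coeff-restrict []             _  = ≈-refl
    coeff-restrict ((a , m') ∷ p) {m} Rm with R? m'
    ... | yes _ with m' ≟ₘ m
    ...   | yes _    = +-congˡ (coeff-restrict p Rm)
    ...   | no  _    = coeff-restrict p Rm
    coeff-restrict ((a , m') ∷ p) {m} Rm | no ¬Rm' with m' ≟ₘ m
    ...   | yes refl = contradiction Rm ¬Rm'
    ...   | no  _    = coeff-restrict p Rm

    coeff-restrict-∉ : ∀ p {m} → ¬ R m → coeff (restrict p) m ≈ 0#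
    coeff-restrict-∉ []             _   = ≈-refl
    coeff-restrict-∉ ((a , m') ∷ p) {m} ¬Rm with R? m'
    ... | no  _   = coeff-restrict-∉ p ¬Rm
    ... | yes Rm' with m' ≟ₘ m
    ...   | yes refl = contradiction Rm' ¬Rm
    ...   | no  _    = coeff-restrict-∉ p ¬Rm

    restrict-cong : ∀ {p q} → p ≈ₚ q → restrict p ≈ₚ restrict q
    restrict-cong {p} {q} p≈q m with R? m
    ... | yes Rm = ≈-trans (coeff-restrict p Rm) (≈-trans (p≈q m) (≈-sym (coeff-restrict q Rm)))
    ... | no ¬Rm = ≈-trans (coeff-restrict-∉ p ¬Rm) (≈-sym (coeff-restrict-∉ q ¬Rm))

    ¬¬-restrict-≈ : ∀ p → (∀ {m} → ¬ R m → ¬ (coeff p m ≉ 0#)) → ¬ ¬ (restrict p ≈ₚ p)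
    ¬¬-restrict-≈ p outside≈0 = ¬¬-map agree (¬¬-coeff-dec p)
      where
      agree : (∀ m → Dec (coeff p m ≈ 0#)) → restrict p ≈ₚ p
      agree dec m with R? m | dec m
      ... | yes Rm | _       = coeff-restrict p Rm
      ... | no ¬Rm | yes p≈0 = ≈-trans (coeff-restrict-∉ p ¬Rm) (≈-sym p≈0)
      ... | no ¬Rm | no  p≉0 = contradiction p≉0 (outside≈0 ¬Rm)

    restrict-*ₚ : ∀ {g} → Homogeneous R g → ∀ h → ∃[ h' ] (restrict (h *ₚ g) ≡ h' *ₚ g)
    restrict-*ₚ         hom []      = [] , refl
    restrict-*ₚ {g = g} hom (s ∷ h) with restrict-*ₚ hom h | hom (proj₂ s)
    ... | h' , eq | inj₁ inside  = s ∷ h' , ≡.trans (List.filter-++ (R? ∘ proj₂) (s • g) (h *ₚ g))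
      (cong₂ _++_ (List.filter-all (R? ∘ proj₂) {s • g} (All.map⁺ inside)) eq)
    ... | h' , eq | inj₂ outside = h' , ≡.trans (List.filter-++ (R? ∘ proj₂) (s • g) (h *ₚ g))
      (cong₂ _++_ (List.filter-none (R? ∘ proj₂) {s • g} (All.map⁺ outside)) eq)

    restrict-*ₚ-avoiding : ∀ {g} → Avoids R g → ∀ h → restrict (h *ₚ g) ≡ []
    restrict-*ₚ-avoiding         avoid []      = refl
    restrict-*ₚ-avoiding {g = g} avoid (s ∷ h) =
      ≡.trans (List.filter-++ (R? ∘ proj₂) (s • g) (h *ₚ g))
              (cong₂ _++_ (List.filter-none (R? ∘ proj₂) {s • g} (All.map⁺ (avoid (proj₂ s))))
                          (restrict-*ₚ-avoiding avoid h))

    module _ {p q} {P : Pred Poly p} {Q : Pred Poly q}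
             (P-homogeneous : ∀ {g} → P g → Homogeneous R g) (Q-avoids : ∀ {g} → Q g → Avoids R g) where

      restrict-combination : ∀ hs → All (λ hg → (P ∪ Q) (proj₂ hg)) hs →
        ∃[ hs' ] (All (λ hg → P (proj₂ hg)) hs' × restrict (combination hs) ≡ combination hs')
      restrict-combination []             []           = [] , [] , refl
      restrict-combination ((h , g) ∷ hs) (gen ∷ gens) with restrict-combination hs gens | gen
      ... | hs' , gens' , eq | inj₁ Pg with restrict-*ₚ (P-homogeneous Pg) h
      ...   | h' , eq' = (h' , g) ∷ hs' , Pg ∷ gens' ,
                         ≡.trans (List.filter-++ (R? ∘ proj₂) (h *ₚ g) _) (cong₂ _++_ eq' eq)
      restrict-combination ((h , g) ∷ hs) (gen ∷ gens) | hs' , gens' , eq | inj₂ Qg =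
        hs' , gens' , ≡.trans (List.filter-++ (R? ∘ proj₂) (h *ₚ g) _)
                              (cong₂ _++_ (restrict-*ₚ-avoiding (Q-avoids Qg) h) eq)

      restrict-Ideal : ∀ f → Ideal (P ∪ Q) f → Ideal P (restrict f)
      restrict-Ideal f (hs , gens , f≈) with restrict-combination hs gens
      ... | hs' , gens' , eq = hs' , gens' , λ m →
        ≈-trans (restrict-cong {f} {combination hs} f≈ m) (reflexive (cong (λ p → coeff p m) eq))

    restrict-Ideal-homogeneous : ∀ {p} {P : Pred Poly p} → (∀ {g} → P g → Homogeneous R g) →
                                 ∀ f → Ideal P f → Ideal P (restrict f)
    restrict-Ideal-homogeneous P-homogeneous f =
      restrict-Ideal {Q = ∅} P-homogeneous (λ ()) f ∘ Ideal-mono inj₁ {f}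

    Ideal-avoids : ∀ {q} {Q : Pred Poly q} → (∀ {g} → Q g → Avoids R g) →
                   ∀ f → Ideal Q f → ∀ {m} → R m → coeff f m ≈ 0#
    Ideal-avoids Q-avoids f I[f] {m} Rm
      with restrict-Ideal {P = ∅} (λ ()) Q-avoids f (Ideal-mono inj₂ {f} I[f])
    ... | [] , [] , restrict≈0 = ≈-trans (≈-sym (coeff-restrict f Rm)) (restrict≈0 m)

  module _ (O : MonomialOrder N) where
    open MonomialOrder O using () renaming (_≤_ to infix 4 _≼_)
    open MonomialOrderProperties O

    IsLM-term : ∀ {a} m → a ≉ 0# → IsLM O ((a , m) ∷ []) m
    IsLM-term {a} m a≉0 = a≉0 ∘ ≈-trans (≈-sym (coeff-term a m)) , λ m' nz → inj₂ (term-support a m m' nz)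

    IsLM-X*X : ∀ i j → IsLM O (X i *ₚ X j) (varₘ i ·ₘ varₘ j)
    IsLM-X*X i j =
      IsLM-term (varₘ i ·ₘ varₘ j) (λ 1*1≈0 → 1≉0 (≈-trans (≈-sym (*-identityˡ 1#)) 1*1≈0))

    IsLM-unique : ∀ {f g u u'} → IsLM O f u → IsLM O g u' → f ≈ₚ g → u ≡ u'
    IsLM-unique {u = u} {u'} (f[u]≉0 , f-max) (g[u']≉0 , g-max) f≈g =
      ≼-antisym (g-max u (f[u]≉0 ∘ ≈-trans (f≈g u))) (f-max u' (g[u']≉0 ∘ ≈-trans (≈-sym (f≈g u'))))

    IsLM-restrict : ∀ {r} {R : Pred (Mon N) r} (R? : Decidable R) {f u} → R u → IsLM O f u →
                    IsLM O (restrict R? f) u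
    IsLM-restrict R? {f} {u} Ru (f[u]≉0 , f-max) =
      f[u]≉0 ∘ ≈-trans (≈-sym (coeff-restrict R? f Ru)) , restricted-max
      where
      restricted-max : ∀ m → coeff (restrict R? f) m ≉ 0# → m ≼ u
      restricted-max m nz with R? m
      ... | yes Rm = f-max m (nz ∘ ≈-trans (coeff-restrict R? f Rm))
      ... | no ¬Rm = contradiction (coeff-restrict-∉ R? f ¬Rm) nz

    leading-monomial : ∀ q → (∀ m → Dec (coeff q m ≈ 0#)) →
                       ∀ {m₀} → coeff q m₀ ≉ 0# → ∃ (IsLM O q)
    leading-monomial q dec {m₀} q[m₀]≉0 =
      max m₀ nonzero , argmax-all id q[m₀]≉0 (All.all-filter nonzero? (monomials q)) ,
      λ m q[m]≉0 → All.lookup (xs≤max m₀ nonzero) (∈-filter⁺ nonzero? (support q q[m]≉0) q[m]≉0)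
      where
      open import Data.List.Extrema totalOrder using (max; argmax-all; xs≤max)
      nonzero? : Decidable (λ m → coeff q m ≉ 0#)
      nonzero? m = ¬? (dec m)
      nonzero : List (Mon N)
      nonzero = filter nonzero? (monomials q)

    ¬¬-leading-monomial : ∀ q {m₀} → coeff q m₀ ≉ 0# → ¬ ¬ ∃ (IsLM O q)
    ¬¬-leading-monomial q nz = ¬¬-map (λ dec → leading-monomial q dec nz) (¬¬-coeff-dec q)

    -- The R-part q of g lies in I, and its leading monomial v is a term of g.
    -- Some u' = LM g' divides v; reducedness forces g' = g, so u ∣ v ≼ u, i.e. v = u,
    -- although v ∈ R and u ∉ R.
    LM∉R⇒terms∉R : ∀ {b i r} {B : Pred Poly b} {I : Pred Poly i} {R : Pred (Mon N) r} (R? : Decidable R) →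
      IsReducedGB O B I → (∀ f → I f → I (restrict R? f)) →
      ∀ {g u} → B g → IsLM O g u → ¬ R u → ∀ {m} → R m → ¬ (coeff g m ≉ 0#)
    LM∉R⇒terms∉R {R = R} R? ((B⊆I , divisible) , _ , reduced) closed {g} {u} Bg lm[g] ¬Ru {m} Rm g[m]≉0 =
      ¬¬-leading-monomial q q[m]≉0 no-leading-monomial
      where
      q : Poly
      q = restrict R? g
      q[m]≉0 : coeff q m ≉ 0#
      q[m]≉0 = g[m]≉0 ∘ ≈-trans (≈-sym (coeff-restrict R? g Rm))
      LM[q]∈R : ∀ {v} → IsLM O q v → R v
      LM[q]∈R {v} (q[v]≉0 , _) with R? v
      ... | yes Rv = Rv
      ... | no ¬Rv = contradiction (coeff-restrict-∉ R? g ¬Rv) q[v]≉0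
      no-leading-monomial : ¬ ∃ (IsLM O q)
      no-leading-monomial (v , lm[q]) with divisible q v (closed g (B⊆I g Bg)) lm[q]
      ... | g' , u' , Bg' , lm[g'] , u'∣v = reduced g g' Bg Bg' g'≉g v u' g[v]≉0 lm[g'] u'∣v
        where
        g[v]≉0 : coeff g v ≉ 0#
        g[v]≉0 = proj₁ lm[q] ∘ ≈-trans (coeff-restrict R? g (LM[q]∈R lm[q]))
        g'≉g : ¬ (g' ≈ₚ g)
        g'≉g g'≈g with IsLM-unique {g'} {g} lm[g'] lm[g] g'≈g
        ... | refl = ¬Ru (subst R (≼-antisym (proj₂ lm[g] v g[v]≉0) (∣ₘ⇒≼ u'∣v)) (LM[q]∈R lm[q]))

module Overlap {d N : ℕ} (S : Fin N → Subset d) where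
  open import Data.Nat using (_+_)

  indicator : Bool → ℕ
  indicator b = if b then 1 else 0

  occurs : Fin d → Subset d → ℕ
  occurs v s = indicator (lookup s v)

  occurs≤1 : ∀ v s → occurs v s ≤ 1
  occurs≤1 v s with lookup s v
  ... | true  = s≤s z≤n
  ... | false = z≤n

  occurs>0⇒∈ : ∀ {v s} → 0 < occurs v s → v ∈ₛ s
  occurs>0⇒∈ {v} {s} _ with lookup s v in s[v]≡
  ... | true = VecP.lookup⇒[]= v s s[v]≡

  ∈⇒occurs≡1 : ∀ {v s} → v ∈ₛ s → occurs v s ≡ 1
  ∈⇒occurs≡1 v∈s rewrite VecP.[]=⇒lookup v∈s = refl

  -- the number of factors x_{S k} of m with v ∈ S k, counted with multiplicity
  multiplicity : Fin d → Mon N → ℕ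
  multiplicity v = weight (λ k → occurs v (S k))

  Overlapping : Pred (Mon N) 0ℓ
  Overlapping m = ∃[ v ] 2 ≤ multiplicity v m

  overlapping? : Decidable Overlapping
  overlapping? m = any? (λ v → 2 ≤? multiplicity v m)

  Overlapping-∣ₘ : ∀ {a b} → a ∣ₘ b → Overlapping a → Overlapping b
  Overlapping-∣ₘ a∣b (v , 2≤) = v , ℕP.≤-trans 2≤ (∣ₘ⇒weight≤ (λ k → occurs v (S k)) a∣b)

  Overlapping-quadratic : ∀ {i j} → Nonempty (S i ∩ S j) → Overlapping (varₘ i ·ₘ varₘ j)
  Overlapping-quadratic {i} {j} (v , v∈S∩S) with x∈p∩q⁻ (S i) (S j) v∈S∩S
  ... | v∈Si , v∈Sj = v , ℕP.≤-reflexive (≡.sym (begin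
    multiplicity v (varₘ i ·ₘ varₘ j)
      ≡⟨ weight-·ₘ _ (varₘ i) (varₘ j) ⟩
    multiplicity v (varₘ i) + multiplicity v (varₘ j)
      ≡⟨ cong₂ _+_ (weight-varₘ _ i) (weight-varₘ _ j) ⟩
    occurs v (S i) + occurs v (S j)
      ≡⟨ cong₂ _+_ (∈⇒occurs≡1 v∈Si) (∈⇒occurs≡1 v∈Sj) ⟩
    2
      ∎))
    where open ≡-Reasoning

  Overlapping-quadratic-multiple : ∀ {i j} → Nonempty (S i ∩ S j) → ∀ m →
                                   Overlapping (m ·ₘ (varₘ i ·ₘ varₘ j))
  Overlapping-quadratic-multiple S∩S≠∅ m =
    Overlapping-∣ₘ (∣ₘ-multiple _ m) (Overlapping-quadratic S∩S≠∅)

  Overlapping⇒quadratic-∣ₘ : ∀ {m} → Overlapping m →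
                             ∃[ i ] ∃[ j ] (Nonempty (S i ∩ S j) × (varₘ i ·ₘ varₘ j) ∣ₘ m)
  Overlapping⇒quadratic-∣ₘ {m} (v , 2≤)
    with weight≥2⇒quadratic-∣ₘ (λ k → occurs v (S k)) (λ k → occurs≤1 v (S k)) m 2≤
  ... | i , j , v∈Si , v∈Sj , x_ix_j∣m =
        i , j , (v , x∈p∩q⁺ (occurs>0⇒∈ v∈Si , occurs>0⇒∈ v∈Sj)) , x_ix_j∣m

module GraphIdealProperties {c ℓ} (𝕂 : Field c ℓ) {d : ℕ} (G : SimpleGraph d) where
  open import Data.Nat using (_+_)
  open Field 𝕂 using (_≈_; 0#)
  open GraphIdeals G
  open PolyRing 𝕂 nVars using (coeff)
  open Polynomial 𝕂 nVars
  open Overlap varSet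

  private
    -- preimage uses a where-bound helper that cannot be named here; comparing
    -- with the constant colouring at f v lets lookup∘tabulate compute it.
    occurs-preimage : ∀ f b v → occurs v (preimage f b) ≡ occurs v (preimage (const (f v)) b)
    occurs-preimage f b v =
      cong indicator (≡.trans (VecP.lookup∘tabulate _ v) (≡.sym (VecP.lookup∘tabulate _ v)))

  colour-classes : ∀ f v →
    occurs v (preimage f true) + occurs v (preimage f false) ≡ indicator (is-just (f v))
  colour-classes f v rewrite occurs-preimage f true v | occurs-preimage f false v with f v
  ... | nothing    rewrite VecP.lookup∘tabulate (const false) v = refl
  ... | just true  rewrite VecP.lookup∘tabulate (const true) v | VecP.lookup∘tabulate (const false) v = refl
  ... | just false rewrite VecP.lookup∘tabulate (const true) v | VecP.lookup∘tabulate (const false) v = refl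

  multiplicity-x_f : ∀ f {i j} → IsXf 𝕂 f i j → ∀ v →
                     multiplicity v (varₘ i ·ₘ varₘ j) ≡ indicator (is-just (f v))
  multiplicity-x_f f {i} {j} (S[i]≡ , S[j]≡) v = begin
    multiplicity v (varₘ i ·ₘ varₘ j)
      ≡⟨ weight-·ₘ _ (varₘ i) (varₘ j) ⟩
    multiplicity v (varₘ i) + multiplicity v (varₘ j)
      ≡⟨ cong₂ _+_ (weight-varₘ _ i) (weight-varₘ _ j) ⟩
    occurs v (varSet i) + occurs v (varSet j)
      ≡⟨ cong₂ _+_ (cong (occurs v) S[i]≡) (cong (occurs v) S[j]≡) ⟩
    occurs v (preimage f true) + occurs v (preimage f false)
      ≡⟨ colour-classes f v ⟩
    indicator (is-just (f v))
      ∎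
    where open ≡-Reasoning

  Overlapping-recolour : ∀ {f f' i j k l} → SameDomain f f' → IsXf 𝕂 f i j → IsXf 𝕂 f' k l → ∀ m →
                         Overlapping (m ·ₘ (varₘ i ·ₘ varₘ j)) → Overlapping (m ·ₘ (varₘ k ·ₘ varₘ l))
  Overlapping-recolour {f} {f'} {i} {j} {k} {l} same x_f x_f' m (v , 2≤) =
    v , subst (2 ≤_) same-multiplicity 2≤
    where
    open ≡-Reasoning
    same-multiplicity : multiplicity v (m ·ₘ (varₘ i ·ₘ varₘ j)) ≡ multiplicity v (m ·ₘ (varₘ k ·ₘ varₘ l))
    same-multiplicity = begin
      multiplicity v (m ·ₘ (varₘ i ·ₘ varₘ j))
        ≡⟨ weight-·ₘ _ m (varₘ i ·ₘ varₘ j) ⟩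
      multiplicity v m + multiplicity v (varₘ i ·ₘ varₘ j)
        ≡⟨ cong (multiplicity v m +_) (multiplicity-x_f f x_f v) ⟩
      multiplicity v m + indicator (is-just (f v))
        ≡⟨ cong ((multiplicity v m +_) ∘ indicator) (same v) ⟩
      multiplicity v m + indicator (is-just (f' v))
        ≡⟨ cong (multiplicity v m +_) (multiplicity-x_f f' x_f' v) ⟨
      multiplicity v m + multiplicity v (varₘ k ·ₘ varₘ l)
        ≡⟨ weight-·ₘ _ m (varₘ k ·ₘ varₘ l) ⟨
      multiplicity v (m ·ₘ (varₘ k ·ₘ varₘ l))
        ∎

  JGen-homogeneous : ∀ {g} → JGen 𝕂 g → Homogeneous Overlapping g
  JGen-homogeneous (f , f' , _ , _ , same , i , j , k , l , x_f , x_f' , refl) m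
    with overlapping? (m ·ₘ (varₘ i ·ₘ varₘ j))
  ... | yes o = inj₁ (o ∷ Overlapping-recolour same x_f x_f' m o ∷ [])
  ... | no ¬o = inj₂ (¬o ∷ ¬o ∘ Overlapping-recolour (≡.sym ∘ same) x_f' x_f m ∷ [])

  JGen-homogeneous-∁ : ∀ {g} → JGen 𝕂 g → Homogeneous (∁ Overlapping) g
  JGen-homogeneous-∁ = Homogeneous-∁ {R = Overlapping} ∘ JGen-homogeneous

  JGen-avoids-low-degree : ∀ {g} → JGen 𝕂 g → Avoids (λ m → degree m < 2) g
  JGen-avoids-low-degree (_ , _ , _ , _ , _ , i , j , k , l , _ , _ , refl) m =
    ℕP.≤⇒≯ (2≤degree-quadratic-multiple m i j) ∷ ℕP.≤⇒≯ (2≤degree-quadratic-multiple m k l) ∷ []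

  MGen-avoids-∁ : ∀ {g} → MGen 𝕂 g → Avoids (∁ Overlapping) g
  MGen-avoids-∁ (i , j , S∩S≠∅ , refl) m = (λ ¬o → ¬o (Overlapping-quadratic-multiple S∩S≠∅ m)) ∷ []

  non-overlapping? : Decidable (∁ Overlapping)
  non-overlapping? = ¬? ∘ overlapping?

  J-restrict-overlapping : ∀ f → J 𝕂 f → J 𝕂 (restrict overlapping? f)
  J-restrict-overlapping = restrict-Ideal-homogeneous overlapping? JGen-homogeneous

  J-restrict-non-overlapping : ∀ f → J 𝕂 f → J 𝕂 (restrict non-overlapping? f)
  J-restrict-non-overlapping = restrict-Ideal-homogeneous non-overlapping? JGen-homogeneous-∁

  K-restrict-non-overlapping : ∀ f → K 𝕂 f → J 𝕂 (restrict non-overlapping? f)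
  K-restrict-non-overlapping = restrict-Ideal non-overlapping? JGen-homogeneous-∁ MGen-avoids-∁

  M-coeff-non-overlapping : ∀ f → M 𝕂 f → ∀ {m} → ¬ Overlapping m → coeff f m ≈ 0#
  M-coeff-non-overlapping = Ideal-avoids non-overlapping? MGen-avoids-∁

  J-coeff-low-degree : ∀ f → J 𝕂 f → ∀ {m} → degree m < 2 → coeff f m ≈ 0#
  J-coeff-low-degree = Ideal-avoids (λ m → degree m <? 2) JGen-avoids-low-degree

  restrict-overlapping∈M : ∀ q → M 𝕂 (restrict overlapping? q)
  restrict-overlapping∈M []            = Ideal-[]
  restrict-overlapping∈M ((a , m) ∷ q) with overlapping? m
  ... | no  _ = restrict-overlapping∈M q
  ... | yes o with Overlapping⇒quadratic-∣ₘ {m} o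
  ...   | i , j , S∩S≠∅ , x_ix_j∣m =
          Ideal-∷ i j (i , j , S∩S≠∅ , refl) x_ix_j∣m (restrict-overlapping∈M q)

module ReducedBasis {c ℓ p} (𝕂 : Field c ℓ) {d : ℕ} (G : SimpleGraph d)
  (O : MonomialOrder (GraphIdeals.nVars G))
  (𝒢₁ : Pred (PolyRing.Poly 𝕂 (GraphIdeals.nVars G)) p)
  (𝒢₁-reduced : PolyRing.IsReducedGB 𝕂 (GraphIdeals.nVars G) O 𝒢₁ (GraphIdeals.J G 𝕂)) where

  open Field 𝕂 renaming (refl to ≈-refl; sym to ≈-sym; trans to ≈-trans)
  open GraphIdeals G
  open PolyRing 𝕂 nVars
  open Polynomial 𝕂 nVars
  open Overlap varSet
  open GraphIdealProperties 𝕂 G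

  𝒢₁⊆J : ∀ g → 𝒢₁ g → J 𝕂 g
  𝒢₁⊆J = proj₁ (proj₁ 𝒢₁-reduced)

  𝒢₁-monic : ∀ g → 𝒢₁ g → ∃[ m ] (IsLM O g m × coeff g m ≈ 1#)
  𝒢₁-monic = proj₁ (proj₂ 𝒢₁-reduced)

  𝒢 : Pred Poly (p ⊔ c ⊔ ℓ)
  𝒢 g = (𝒢₁ g × ¬ M 𝕂 g) ⊎ MGen 𝕂 g

  -- Otherwise every term of g would be overlapping, putting g in M.
  LM-non-overlapping : ∀ {g u} → 𝒢₁ g → ¬ M 𝕂 g → IsLM O g u → ¬ Overlapping u
  LM-non-overlapping {g} 𝒢₁g g∉M lm[g] o =
    ¬¬-restrict-≈ overlapping? g terms-overlapping λ restrict≈g →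
      g∉M (Ideal-resp-≈ {f = restrict overlapping? g} {g} restrict≈g (restrict-overlapping∈M g))
    where
    terms-overlapping : ∀ {m} → ¬ Overlapping m → ¬ (coeff g m ≉ 0#)
    terms-overlapping =
      LM∉R⇒terms∉R O non-overlapping? 𝒢₁-reduced J-restrict-non-overlapping 𝒢₁g lm[g] (λ ¬o → ¬o o)

  terms-non-overlapping : ∀ {g m} → 𝒢₁ g → ¬ M 𝕂 g → coeff g m ≉ 0# → ¬ Overlapping m
  terms-non-overlapping {g} 𝒢₁g g∉M g[m]≉0 o with 𝒢₁-monic g 𝒢₁g
  ... | u , lm[g] , _ = LM∉R⇒terms∉R O overlapping? 𝒢₁-reduced J-restrict-overlapping
                          𝒢₁g lm[g] (LM-non-overlapping 𝒢₁g g∉M lm[g]) o g[m]≉0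

  -- A non-overlapping divisor of the overlapping x_i x_j is proper, so has degree < 2,
  -- where J has no terms.
  LM∤quadratic : ∀ {g u i j} → 𝒢₁ g → ¬ M 𝕂 g → IsLM O g u → Nonempty (varSet i ∩ varSet j) →
                 ¬ (u ∣ₘ (varₘ i ·ₘ varₘ j))
  LM∤quadratic {g} {u} {i} {j} 𝒢₁g g∉M lm[g] S∩S≠∅ u∣x_ix_j =
    proj₁ lm[g] (J-coeff-low-degree g (𝒢₁⊆J g 𝒢₁g) degree<2)
    where
    u≢x_ix_j : u ≢ varₘ i ·ₘ varₘ j
    u≢x_ix_j refl = LM-non-overlapping 𝒢₁g g∉M lm[g] (Overlapping-quadratic S∩S≠∅)
    degree<2 : degree u < 2
    degree<2 = ℕP.≤∧≢⇒<
      (subst (degree u ≤_) (degree-quadratic i j) (∣ₘ⇒weight≤ (const 1) u∣x_ix_j))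
      (u≢x_ix_j ∘ ∣ₘ∧degree≡⇒≡ u∣x_ix_j ∘ flip ≡.trans (≡.sym (degree-quadratic i j)))

  𝒢⊆K : ∀ g → 𝒢 g → K 𝕂 g
  𝒢⊆K g (inj₁ (𝒢₁g , _))            = Ideal-mono inj₁ {g} (𝒢₁⊆J g 𝒢₁g)
  𝒢⊆K _ (inj₂ (i , j , S∩S≠∅ , refl)) = Ideal-X*X i j (inj₂ (i , j , S∩S≠∅ , refl))

  𝒢-divisible : ∀ f m → K 𝕂 f → IsLM O f m → ∃[ g ] ∃[ m' ] (𝒢 g × IsLM O g m' × m' ∣ₘ m)
  𝒢-divisible f m Kf lm[f] with overlapping? m
  ... | yes o with Overlapping⇒quadratic-∣ₘ {m} o
  ...   | i , j , S∩S≠∅ , x_ix_j∣m =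
          X i *ₚ X j , varₘ i ·ₘ varₘ j , inj₂ (i , j , S∩S≠∅ , refl) , IsLM-X*X O i j , x_ix_j∣m
  𝒢-divisible f m Kf lm[f] | no ¬o
    with proj₂ (proj₁ 𝒢₁-reduced) (restrict non-overlapping? f) m
           (K-restrict-non-overlapping f Kf) (IsLM-restrict O non-overlapping? {f} ¬o lm[f])
  ... | g , m' , 𝒢₁g , lm[g] , m'∣m = g , m' , inj₁ (𝒢₁g , g∉M) , lm[g] , m'∣m
    where
    g∉M : ¬ M 𝕂 g
    g∉M Mg = proj₁ lm[g] (M-coeff-non-overlapping g Mg (¬o ∘ Overlapping-∣ₘ m'∣m))

  𝒢-monic : ∀ g → 𝒢 g → ∃[ m ] (IsLM O g m × coeff g m ≈ 1#)
  𝒢-monic g (inj₁ (𝒢₁g , _))          = 𝒢₁-monic g 𝒢₁g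
  𝒢-monic _ (inj₂ (i , j , _ , refl)) = varₘ i ·ₘ varₘ j , IsLM-X*X O i j , coeff-X*X i j

  𝒢-interreduced : ∀ g g' → 𝒢 g → 𝒢 g' → ¬ (g' ≈ₚ g) →
                   ∀ m m' → coeff g m ≉ 0# → IsLM O g' m' → ¬ (m' ∣ₘ m)
  𝒢-interreduced g g' (inj₁ (𝒢₁g , _)) (inj₁ (𝒢₁g' , _)) =
    proj₂ (proj₂ 𝒢₁-reduced) g g' 𝒢₁g 𝒢₁g'
  𝒢-interreduced g _ (inj₁ (𝒢₁g , g∉M)) (inj₂ (k , l , S∩S≠∅ , refl)) _ m m' g[m]≉0 lm[g'] m'∣m
    with support-X*X k l m' (proj₁ lm[g'])
  ... | refl = terms-non-overlapping 𝒢₁g g∉M g[m]≉0 (Overlapping-∣ₘ m'∣m (Overlapping-quadratic S∩S≠∅))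
  𝒢-interreduced _ g' (inj₂ (i , j , S∩S≠∅ , refl)) (inj₁ (𝒢₁g' , g'∉M)) _ m m' g[m]≉0 lm[g'] m'∣m
    with support-X*X i j m g[m]≉0
  ... | refl = LM∤quadratic 𝒢₁g' g'∉M lm[g'] S∩S≠∅ m'∣m
  𝒢-interreduced _ _ (inj₂ (i , j , _ , refl)) (inj₂ (k , l , _ , refl)) g'≉g m m' g[m]≉0 lm[g'] m'∣m
    with support-X*X i j m g[m]≉0 | support-X*X k l m' (proj₁ lm[g'])
  ... | refl | refl = g'≉g (coeff-∷-cong {p = []} {q = []} ≈-refl
                              (quadratic-∣ₘ-quadratic {i = i} {j} {k} {l} m'∣m) (λ _ → ≈-refl))

proposition6p4 : ∀ {c ℓ p} (𝕂 : Field c ℓ) (d : ℕ) (G : SimpleGraph d)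
    (O : MonomialOrder (GraphIdeals.nVars G))
    (𝒢₁ : Pred (PolyRing.Poly 𝕂 (GraphIdeals.nVars G)) p) →
    PolyRing.IsReducedGB 𝕂 (GraphIdeals.nVars G) O 𝒢₁ (GraphIdeals.J G 𝕂) →
    PolyRing.IsReducedGB 𝕂 (GraphIdeals.nVars G) O
      (λ g → (𝒢₁ g × ¬ GraphIdeals.M G 𝕂 g) ⊎ GraphIdeals.MGen G 𝕂 g)
      (GraphIdeals.K G 𝕂)
proposition6p4 𝕂 d G O 𝒢₁ 𝒢₁-reduced = (𝒢⊆K , 𝒢-divisible) , 𝒢-monic , 𝒢-interreduced
  where open ReducedBasis 𝕂 G O 𝒢₁ 𝒢₁-reduced
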